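{- In any implicative structure $(\mathscr A,\preceq,\multimap)$ the following semantic typing rules are valid: (i) if $\Gamma\vdash t:a$ and $\Delta\vdash u:b$ (with $\mathrm{dom}(\Gamma)\cap\mathrm{dom}(\Delta)=\emptyset$ and $z$ a fresh variable), then $\Gamma,\Delta\vdash\lambda z.ztu:a\otimes b$; (ii) if $\Gamma,x:a,y:b\vdash t:c$ (with $z$ fresh), then $\Gamma,z:a\otimes b\vdash z(\lambda xy.t):c$.
   Context: An implicative structure is a complete lattice $(\mathscr A,\preceq)$ with a binary operation $\multimap$ (right-associative) such that $a'\preceq a$, $b\preceq b'$ imply $(a\multimap b)\preceq(a'\multimap b')$, and $a\multimap\bigwedge_{b\in B}b=\bigwedge_{b\in B}(a\multimap b)$. Application: $ab=\bigwedge\{c\mid a\preceq(b\multimap c)\}$. Closed $\lambda$-terms with parameters in $\mathscr A$ are interpreted by $a^{\mathscr A}=a$, $(tu)^{\mathscr A}=t^{\mathscr A}u^{\mathscr A}$, $(\lambda x.t)^{\mathscr A}=\bigwedge_{a}(a\multimap(t\{x:=a\})^{\mathscr A})$. Tensor: $a\otimes b:=\bigwedge_{c\in\mathscr A}((a\multimap b\multimap c)\multimap c)$. A typing context $\Gamma=x_1:a_1,\ldots,x_n:a_n$ is a finite list of pairwise distinct variables with $a_i\in\mathscr A$, also viewed as the substitution $x_i:=a_i$; $\Gamma,\Delta$ denotes concatenation of contexts with disjoint domains. The judgement $\Gamma\vdash t:a$ (for $t$ a $\lambda$-term with parameters in $\mathscr A$) means: the free variables of $t$ are in $\mathrm{dom}(\Gamma)$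 and $(t[\Gamma])^{\mathscr A}\preceq a$. -}

module Defs where

open import Level using (Level; _⊔_) renaming (suc to lsuc)
open import Data.Nat using (ℕ; zero; suc; _+_; _≡ᵇ_)
open import Data.Empty using (⊥)
open import Data.Bool using (if_then_else_)
open import Data.Product using (Σ; _×_; _,_; proj₁)
open import Data.List using (List; []; _∷_; map; _++_)
open import Data.List.Membership.Propositional using (_∈_)
open import Relation.Binary.PropositionalEquality using (_≡_)

Var : Set
Var = ℕ

record ImplicativeStructure (ℓ : Level) : Set (lsuc ℓ) where
  infixr 5 _⊸_
  infix 4 _≼_
  field
    Carrier   : Set ℓ
    _≼_       : Carrier → Carrier → Set ℓ
    ≼-refl    : ∀ {a} → a ≼ a
    ≼-trans   : ∀ {a b c} → a ≼ b → b ≼ c → a ≼ c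
    ≼-antisym : ∀ {a b} → a ≼ b → b ≼ a → a ≡ b
    ⋀         : (Carrier → Set ℓ) → Carrier
    ⋀-lower   : ∀ (B : Carrier → Set ℓ) {b} → B b → ⋀ B ≼ b
    ⋀-greatest : ∀ (B : Carrier → Set ℓ) {a} → (∀ {b} → B b → a ≼ b) → a ≼ ⋀ B
    _⊸_       : Carrier → Carrier → Carrier
    ⊸-mono    : ∀ {a a' b b'} → a' ≼ a → b ≼ b' → (a ⊸ b) ≼ (a' ⊸ b')
    ⊸-⋀       : ∀ (a : Carrier) (B : Carrier → Set ℓ) →
                a ⊸ ⋀ B ≡ ⋀ (λ c → Σ Carrier (λ b → B b × (c ≡ a ⊸ b)))

module _ {ℓ : Level} (𝒜 : ImplicativeStructure ℓ) where
  open ImplicativeStructure 𝒜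

  ⊤ᴬ : Carrier
  ⊤ᴬ = ⋀ (λ _ → Level.Lift ℓ ⊥)

  appᴬ : Carrier → Carrier → Carrier
  appᴬ a b = ⋀ (λ c → a ≼ (b ⊸ c))

  _⊗_ : Carrier → Carrier → Carrier
  a ⊗ b = ⋀ (λ d → Σ Carrier (λ c → d ≡ ((a ⊸ b ⊸ c) ⊸ c)))

  data Term : Set ℓ where
    var : Var → Term
    par : Carrier → Term
    app : Term → Term → Term
    lam : Var → Term → Term

  data FreeIn (x : Var) : Term → Set ℓ where
    fv-var  : FreeIn x (var x)
    fv-appˡ : ∀ {t u} → FreeIn x t → FreeIn x (app t u)
    fv-appʳ : ∀ {t u} → FreeIn x u → FreeIn x (app t u)
    fv-lam  : ∀ {y t} → (x ≡ y → ⊥) → FreeIn x t → FreeIn x (lam y t)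

  _⟨_≔_⟩ : Term → Var → Carrier → Term
  var y   ⟨ x ≔ a ⟩ = if x ≡ᵇ y then par a else var y
  par b   ⟨ x ≔ a ⟩ = par b
  app t u ⟨ x ≔ a ⟩ = app (t ⟨ x ≔ a ⟩) (u ⟨ x ≔ a ⟩)
  lam y t ⟨ x ≔ a ⟩ = if x ≡ᵇ y then lam y t else lam y (t ⟨ x ≔ a ⟩)

  -- size of a term (preserved by substitution of parameters)
  size : Term → ℕ
  size (var _)   = 1
  size (par _)   = 1
  size (app t u) = suc (size t + size u)
  size (lam _ t) = suc (size t)

  -- interpretation (of closed terms), by recursion on a size bound:
  --   a^𝒜 = a, (tu)^𝒜 = t^𝒜 u^𝒜, (λx.t)^𝒜 = ⋀_a (a ⊸ (t{x:=a})^𝒜)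
  -- (free variables, which never occur in closed terms, get ⊤)
  interp′ : ℕ → Term → Carrier
  interp′ zero    _         = ⊤ᴬ
  interp′ (suc n) (var _)   = ⊤ᴬ
  interp′ (suc n) (par a)   = a
  interp′ (suc n) (app t u) = appᴬ (interp′ n t) (interp′ n u)
  interp′ (suc n) (lam x t) =
    ⋀ (λ d → Σ Carrier (λ a → d ≡ (a ⊸ interp′ n (t ⟨ x ≔ a ⟩))))

  ⟦_⟧ : Term → Carrier
  ⟦ t ⟧ = interp′ (size t) t

  Context : Set ℓ
  Context = List (Var × Carrier)

  dom : Context → List Var
  dom Γ = map proj₁ Γ

  -- Γ viewed as the substitution xᵢ := aᵢ (parameters are closed,
  -- so sequential = simultaneous substitution)
  _[_] : Term → Context → Term
  t [ [] ]          = t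
  t [ (x , a) ∷ Γ ] = (t ⟨ x ≔ a ⟩) [ Γ ]

  _⊢_∶_ : Context → Term → Carrier → Set ℓ
  Γ ⊢ t ∶ a = (∀ x → FreeIn x t → x ∈ dom Γ) × (⟦ t [ Γ ] ⟧ ≼ a)

-- The tensor a ⊗ b is the meet of all (a ⊸ b ⊸ c) ⊸ c.  Introduction is its
-- universal property as a meet: λz.ztu lies below d ⊸ (d t u) for d = a ⊸ b ⊸ c,
-- and d t u ≼ c because application is left adjoint to ⊸ (f ≼ a ⊸ b ⇒ f a ≼ b).
-- Elimination is the lower bound at c itself: (a ⊗ b)(λxy.t) ≼ c as soon as
-- λxy.t ≼ a ⊸ b ⊸ c.  The remaining work is syntactic: a closing substitution
-- passes under binders outside its domain and leaves closed subterms untouched,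
-- so both terms can be computed after substituting the context.
module Submission where

import Defs as D
open D using (ImplicativeStructure; Var; var; par; app; lam; fv-var; fv-appˡ; fv-appʳ; fv-lam)
open import Level using (Level)
open import Data.Nat using (ℕ; suc; _+_; _≤_; s≤s; _≡ᵇ_; _≟_)
open import Data.Nat.Properties using (≤-refl; ≤-trans; ≤-reflexive; m≤m+n; m≤n+m)
open import Data.Product using (_×_; _,_; Σ; proj₁)
open import Data.Sum using (_⊎_; inj₁; inj₂)
open import Data.Bool using (true; false)
open import Data.Empty using (⊥-elim)
open import Function using (_∘_)
open import Data.List using (List; []; _∷_; _++_)
open import Data.List.Properties using (map-++)
open import Data.List.Membership.Propositional using (_∉_; _∈_)
open import Data.List.Membership.Propositional.Properties using (∈-++⁺ˡ; ∈-++⁺ʳ; ∈-++⁻)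
open import Data.List.Relation.Unary.Any using (here; there)
open import Data.List.Relation.Unary.All as All using ()
open import Data.List.Relation.Unary.AllPairs using (_∷_)
open import Data.List.Relation.Unary.Unique.Propositional using (Unique)
open import Data.List.Relation.Unary.Unique.Propositional.Properties using (Unique[x∷xs]⇒x∉xs)
open import Data.List.Relation.Binary.Disjoint.Propositional using (Disjoint)
open import Relation.Nullary using (¬_; proof)
open import Relation.Nullary.Reflects using (Reflects; ofʸ; ofⁿ)
open import Relation.Binary.Bundles using (Preorder)
import Relation.Binary.Reasoning.Preorder
open import Relation.Binary.PropositionalEquality
  using (_≢_; _≡_; refl; sym; trans; cong; cong₂; subst; isEquivalence; module ≡-Reasoning)

module _ {a} {A : Set a} where

  Unique-++⇒Disjoint : ∀ xs {ys : List A} → Unique (xs ++ ys) → Disjoint xs ys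
  Unique-++⇒Disjoint (x ∷ xs) (x≢xs++ys ∷ _)  (here refl , v∈ys) =
    All.lookup x≢xs++ys (∈-++⁺ʳ xs v∈ys) refl
  Unique-++⇒Disjoint (x ∷ xs) (_ ∷ xs++ys!) (there v∈xs , v∈ys) =
    Unique-++⇒Disjoint xs xs++ys! (v∈xs , v∈ys)

  Unique-++⇒Uniqueʳ : ∀ xs {ys : List A} → Unique (xs ++ ys) → Unique ys
  Unique-++⇒Uniqueʳ []       ys!            = ys!
  Unique-++⇒Uniqueʳ (x ∷ xs) (_ ∷ xs++ys!) = Unique-++⇒Uniqueʳ xs xs++ys!

≡ᵇ-reflects-≡ : ∀ m n → Reflects (m ≡ n) (m ≡ᵇ n)
≡ᵇ-reflects-≡ m n = proof (m ≟ n)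

module TensorRules {ℓ : Level} (𝒜 : ImplicativeStructure ℓ) where
  open ImplicativeStructure 𝒜

  Term : Set ℓ
  Term = D.Term 𝒜

  Context : Set ℓ
  Context = D.Context 𝒜

  dom : Context → List Var
  dom = D.dom 𝒜

  FreeIn : Var → Term → Set ℓ
  FreeIn = D.FreeIn 𝒜

  _⟨_≔_⟩ : Term → Var → Carrier → Term
  _⟨_≔_⟩ = D._⟨_≔_⟩ 𝒜

  size : Term → ℕ
  size = D.size 𝒜

  interp′ : ℕ → Term → Carrier
  interp′ = D.interp′ 𝒜

  ⟦_⟧ : Term → Carrier
  ⟦_⟧ = D.⟦_⟧ 𝒜

  _[_] : Term → Context → Term
  _[_] = D._[_] 𝒜

  appᴬ : Carrier → Carrier → Carrier
  appᴬ = D.appᴬ 𝒜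

  infixr 6 _⊗_
  infix  4 _⊢_∶_

  _⊗_ : Carrier → Carrier → Carrier
  _⊗_ = D._⊗_ 𝒜

  _⊢_∶_ : Context → Term → Carrier → Set ℓ
  _⊢_∶_ = D._⊢_∶_ 𝒜

  private
    variable
      a b c d e : Carrier
      x y z w : Var
      t u : Term
      Γ Δ : Context

  ≼-preorder : Preorder ℓ ℓ ℓ
  ≼-preorder = record
    { Carrier    = Carrier
    ; _≈_        = _≡_
    ; _≲_        = _≼_
    ; isPreorder = record
      { isEquivalence = isEquivalence
      ; reflexive     = λ { refl → ≼-refl }
      ; trans         = ≼-trans
      }
    }

  module ≼-Reasoning = Relation.Binary.Reasoning.Preorder ≼-preorder

  ⊸-monoʳ : b ≼ c → a ⊸ b ≼ a ⊸ c
  ⊸-monoʳ b≼c = ⊸-mono ≼-refl b≼c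

  -- ⟦ lam x t ⟧ and a ⊗ b are both meets of this form.
  ⨅ : (Carrier → Carrier) → Carrier
  ⨅ f = ⋀ (λ d → Σ Carrier (λ a → d ≡ f a))

  ⨅-lower : ∀ (f : Carrier → Carrier) a → ⨅ f ≼ f a
  ⨅-lower f a = ⋀-lower _ (a , refl)

  ⨅-greatest : ∀ (f : Carrier → Carrier) → (∀ a → d ≼ f a) → d ≼ ⨅ f
  ⨅-greatest f d≼f = ⋀-greatest _ λ { (a , refl) → d≼f a }

  ⨅-cong : ∀ {f g : Carrier → Carrier} → (∀ a → f a ≡ g a) → ⨅ f ≡ ⨅ g
  ⨅-cong {f} {g} f≗g = ≼-antisym
    (⨅-greatest g λ a → subst (⨅ f ≼_) (f≗g a) (⨅-lower f a))
    (⨅-greatest f λ a → subst (⨅ g ≼_) (sym (f≗g a)) (⨅-lower g a))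

  appᴬ-lower : d ≼ a ⊸ b → appᴬ d a ≼ b
  appᴬ-lower d≼a⊸b = ⋀-lower _ d≼a⊸b

  ⊸-elim₂ : a ≼ c → b ≼ d → appᴬ (appᴬ (c ⊸ d ⊸ e) a) b ≼ e
  ⊸-elim₂ a≼c b≼d = appᴬ-lower (≼-trans (appᴬ-lower (⊸-mono a≼c ≼-refl)) (⊸-mono b≼d ≼-refl))

  ⊗-greatest : (∀ c → d ≼ (a ⊸ b ⊸ c) ⊸ c) → d ≼ a ⊗ b
  ⊗-greatest = ⨅-greatest _

  ⊗-elim : d ≼ a ⊸ b ⊸ c → appᴬ (a ⊗ b) d ≼ c
  ⊗-elim {c = c} d≼a⊸b⊸c = appᴬ-lower (≼-trans (⨅-lower _ c) (⊸-mono d≼a⊸b⊸c ≼-refl))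

  ⟨≔⟩-var-≡ : var x ⟨ x ≔ a ⟩ ≡ par a
  ⟨≔⟩-var-≡ {x} with x ≡ᵇ x | ≡ᵇ-reflects-≡ x x
  ... | true  | _        = refl
  ... | false | ofⁿ x≢x = ⊥-elim (x≢x refl)

  ⟨≔⟩-var-≢ : x ≢ y → var y ⟨ x ≔ a ⟩ ≡ var y
  ⟨≔⟩-var-≢ {x} {y} x≢y with x ≡ᵇ y | ≡ᵇ-reflects-≡ x y
  ... | true  | ofʸ x≡y = ⊥-elim (x≢y x≡y)
  ... | false | _       = refl

  ⟨≔⟩-lam-≢ : x ≢ y → lam y t ⟨ x ≔ a ⟩ ≡ lam y (t ⟨ x ≔ a ⟩)
  ⟨≔⟩-lam-≢ {x} {y} x≢y with x ≡ᵇ y | ≡ᵇ-reflects-≡ x y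
  ... | true  | ofʸ x≡y = ⊥-elim (x≢y x≡y)
  ... | false | _       = refl

  size-⟨≔⟩ : ∀ t → size (t ⟨ x ≔ a ⟩) ≡ size t
  size-⟨≔⟩ {x} (var y) with x ≡ᵇ y
  ... | true  = refl
  ... | false = refl
  size-⟨≔⟩ (par b)   = refl
  size-⟨≔⟩ (app t u) = cong₂ (λ m n → suc (m + n)) (size-⟨≔⟩ t) (size-⟨≔⟩ u)
  size-⟨≔⟩ {x} (lam y t) with x ≡ᵇ y
  ... | true  = refl
  ... | false = cong suc (size-⟨≔⟩ t)

  FreeIn-⟨≔⟩⁻ : ∀ t → FreeIn w (t ⟨ x ≔ a ⟩) → FreeIn w t × w ≢ x
  FreeIn-⟨≔⟩⁻ {x = x} (var y) w∈ with x ≡ᵇ y | ≡ᵇ-reflects-≡ x y | w∈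
  ... | false | ofⁿ x≢y | fv-var = fv-var , λ { refl → x≢y refl }
  FreeIn-⟨≔⟩⁻ (app t u) (fv-appˡ w∈t) with FreeIn-⟨≔⟩⁻ t w∈t
  ... | w∈t′ , w≢x = fv-appˡ w∈t′ , w≢x
  FreeIn-⟨≔⟩⁻ (app t u) (fv-appʳ w∈u) with FreeIn-⟨≔⟩⁻ u w∈u
  ... | w∈u′ , w≢x = fv-appʳ w∈u′ , w≢x
  FreeIn-⟨≔⟩⁻ {x = x} (lam y t) w∈ with x ≡ᵇ y | ≡ᵇ-reflects-≡ x y | w∈
  ... | true  | ofʸ refl | fv-lam w≢y w∈t = fv-lam w≢y w∈t , w≢y
  ... | false | _        | fv-lam w≢y w∈t with FreeIn-⟨≔⟩⁻ t w∈t
  ...   | w∈t′ , w≢x = fv-lam w≢y w∈t′ , w≢x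

  ⟨≔⟩-fresh : ∀ t → ¬ FreeIn x t → t ⟨ x ≔ a ⟩ ≡ t
  ⟨≔⟩-fresh {x} (var y) x∉ = ⟨≔⟩-var-≢ {x} {y} λ { refl → x∉ fv-var }
  ⟨≔⟩-fresh (par b)   x∉ = refl
  ⟨≔⟩-fresh (app t u) x∉ =
    cong₂ app (⟨≔⟩-fresh t (x∉ ∘ fv-appˡ)) (⟨≔⟩-fresh u (x∉ ∘ fv-appʳ))
  ⟨≔⟩-fresh {x} (lam y t) x∉ with x ≡ᵇ y | ≡ᵇ-reflects-≡ x y
  ... | true  | _       = refl
  ... | false | ofⁿ x≢y = cong (lam y) (⟨≔⟩-fresh t (x∉ ∘ fv-lam x≢y))

  interp′-fuel : ∀ m n t → size t ≤ m → size t ≤ n → interp′ m t ≡ interp′ n t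
  interp′-fuel (suc m) (suc n) (var x)   _       _       = refl
  interp′-fuel (suc m) (suc n) (par a)   _       _       = refl
  interp′-fuel (suc m) (suc n) (app t u) (s≤s p) (s≤s q) = cong₂ appᴬ
    (interp′-fuel m n t (≤-trans (m≤m+n _ _) p) (≤-trans (m≤m+n _ _) q))
    (interp′-fuel m n u (≤-trans (m≤n+m _ _) p) (≤-trans (m≤n+m _ _) q))
  interp′-fuel (suc m) (suc n) (lam x t) (s≤s p) (s≤s q) = ⨅-cong λ a →
    cong (a ⊸_) (interp′-fuel m n (t ⟨ x ≔ a ⟩)
      (subst (_≤ m) (sym (size-⟨≔⟩ t)) p) (subst (_≤ n) (sym (size-⟨≔⟩ t)) q))

  interp′≡⟦⟧ : ∀ n t → size t ≤ n → interp′ n t ≡ ⟦ t ⟧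
  interp′≡⟦⟧ n t p = interp′-fuel n (size t) t p ≤-refl

  ⟦app⟧ : ∀ t u → ⟦ app t u ⟧ ≡ appᴬ ⟦ t ⟧ ⟦ u ⟧
  ⟦app⟧ t u = cong₂ appᴬ (interp′≡⟦⟧ n t (m≤m+n _ _)) (interp′≡⟦⟧ n u (m≤n+m _ _))
    where
      n : ℕ
      n = size t + size u

  ⟦lam⟧ : ∀ x t → ⟦ lam x t ⟧ ≡ ⨅ (λ a → a ⊸ ⟦ t ⟨ x ≔ a ⟩ ⟧)
  ⟦lam⟧ x t = ⨅-cong λ a → cong (a ⊸_) (interp′≡⟦⟧ _ (t ⟨ x ≔ a ⟩) (≤-reflexive (size-⟨≔⟩ t)))

  ⟦lam⟧-≼ : ∀ x t a → ⟦ lam x t ⟧ ≼ a ⊸ ⟦ t ⟨ x ≔ a ⟩ ⟧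
  ⟦lam⟧-≼ x t a = subst (_≼ a ⊸ ⟦ t ⟨ x ≔ a ⟩ ⟧) (sym (⟦lam⟧ x t)) (⨅-lower _ a)

  Closed : Term → Set ℓ
  Closed t = ∀ x → ¬ FreeIn x t

  ⟦pair⟧-≼ : Closed t → Closed u → ⟦ t ⟧ ≼ a → ⟦ u ⟧ ≼ b →
             ⟦ lam z (app (app (var z) t) u) ⟧ ≼ a ⊗ b
  ⟦pair⟧-≼ {t} {u} {a} {b} {z} t-closed u-closed ⟦t⟧≼a ⟦u⟧≼b = ⊗-greatest λ c →
    ≼-trans (applied (a ⊸ b ⊸ c)) (⊸-monoʳ (⊸-elim₂ ⟦t⟧≼a ⟦u⟧≼b))
    where
      open ≼-Reasoning
      plugged : ∀ d → app (app (var z) t) u ⟨ z ≔ d ⟩ ≡ app (app (par d) t) u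
      plugged d = cong₂ app (cong₂ app (⟨≔⟩-var-≡ {z}) (⟨≔⟩-fresh t (t-closed z)))
                            (⟨≔⟩-fresh u (u-closed z))
      applied : ∀ d → ⟦ lam z (app (app (var z) t) u) ⟧ ≼ d ⊸ appᴬ (appᴬ d ⟦ t ⟧) ⟦ u ⟧
      applied d = begin
        ⟦ lam z (app (app (var z) t) u) ⟧          ≲⟨ ⟦lam⟧-≼ z (app (app (var z) t) u) d ⟩
        d ⊸ ⟦ app (app (var z) t) u ⟨ z ≔ d ⟩ ⟧   ≡⟨ cong (λ s → d ⊸ ⟦ s ⟧) (plugged d) ⟩
        d ⊸ ⟦ app (app (par d) t) u ⟧              ≡⟨ cong (d ⊸_) (⟦app⟧ (app (par d) t) u) ⟩
        d ⊸ appᴬ ⟦ app (par d) t ⟧ ⟦ u ⟧           ≡⟨ cong (λ s → d ⊸ appᴬ s ⟦ u ⟧) (⟦app⟧ (par d) t) ⟩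
        d ⊸ appᴬ (appᴬ d ⟦ t ⟧) ⟦ u ⟧              ∎

  ⟦unpair⟧-≼ : x ≢ y → ⟦ t ⟨ x ≔ a ⟩ ⟨ y ≔ b ⟩ ⟧ ≼ c →
               ⟦ app (par (a ⊗ b)) (lam x (lam y t)) ⟧ ≼ c
  ⟦unpair⟧-≼ {x} {y} {t} {a} {b} {c} x≢y ⟦t⟧≼c = begin
    ⟦ app (par (a ⊗ b)) (lam x (lam y t)) ⟧   ≡⟨ ⟦app⟧ (par (a ⊗ b)) (lam x (lam y t)) ⟩
    appᴬ (a ⊗ b) ⟦ lam x (lam y t) ⟧          ≲⟨ ⊗-elim curried ⟩
    c                                         ∎
    where
      open ≼-Reasoning
      curried : ⟦ lam x (lam y t) ⟧ ≼ a ⊸ b ⊸ c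
      curried = begin
        ⟦ lam x (lam y t) ⟧                  ≲⟨ ⟦lam⟧-≼ x (lam y t) a ⟩
        a ⊸ ⟦ lam y t ⟨ x ≔ a ⟩ ⟧            ≡⟨ cong (λ s → a ⊸ ⟦ s ⟧) (⟨≔⟩-lam-≢ x≢y) ⟩
        a ⊸ ⟦ lam y (t ⟨ x ≔ a ⟩) ⟧          ≲⟨ ⊸-monoʳ (⟦lam⟧-≼ y (t ⟨ x ≔ a ⟩) b) ⟩
        a ⊸ b ⊸ ⟦ t ⟨ x ≔ a ⟩ ⟨ y ≔ b ⟩ ⟧    ≲⟨ ⊸-monoʳ (⊸-monoʳ ⟦t⟧≼c) ⟩
        a ⊸ b ⊸ c                            ∎

  FreeIn-[]⁻ : ∀ t Γ → FreeIn w (t [ Γ ]) → FreeIn w t × w ∉ dom Γ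
  FreeIn-[]⁻ t []            w∈ = w∈ , λ ()
  FreeIn-[]⁻ t ((x , a) ∷ Γ) w∈ with FreeIn-[]⁻ (t ⟨ x ≔ a ⟩) Γ w∈
  ... | w∈t′ , w∉Γ with FreeIn-⟨≔⟩⁻ t w∈t′
  ...   | w∈t , w≢x = w∈t , λ { (here w≡x) → w≢x w≡x ; (there w∈Γ) → w∉Γ w∈Γ }

  []-closed : ∀ t Γ → (∀ x → FreeIn x t → x ∈ dom Γ) → Closed (t [ Γ ])
  []-closed t Γ fv⊆Γ x x∈ with FreeIn-[]⁻ t Γ x∈
  ... | x∈t , x∉Γ = x∉Γ (fv⊆Γ x x∈t)

  []-fresh : ∀ t Γ → (∀ x → FreeIn x t → x ∉ dom Γ) → t [ Γ ] ≡ t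
  []-fresh t []            _      = refl
  []-fresh t ((x , a) ∷ Γ) fv#Γ = trans
    (cong (_[ Γ ]) (⟨≔⟩-fresh t λ x∈t → fv#Γ x x∈t (here refl)))
    ([]-fresh t Γ λ y y∈t y∈Γ → fv#Γ y y∈t (there y∈Γ))

  []-closed-id : ∀ t Γ → Closed t → t [ Γ ] ≡ t
  []-closed-id t Γ t-closed = []-fresh t Γ λ x x∈t _ → t-closed x x∈t

  []-++ : ∀ t Γ Δ → t [ Γ ++ Δ ] ≡ t [ Γ ] [ Δ ]
  []-++ t []            Δ = refl
  []-++ t ((x , a) ∷ Γ) Δ = []-++ (t ⟨ x ≔ a ⟩) Γ Δ

  []-app : ∀ t u Γ → app t u [ Γ ] ≡ app (t [ Γ ]) (u [ Γ ])
  []-app t u []            = refl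
  []-app t u ((x , a) ∷ Γ) = []-app (t ⟨ x ≔ a ⟩) (u ⟨ x ≔ a ⟩) Γ

  []-var : ∀ Γ → z ∉ dom Γ → var z [ Γ ] ≡ var z
  []-var []            _   = refl
  []-var {z} ((x , a) ∷ Γ) z∉ = trans
    (cong (_[ Γ ]) (⟨≔⟩-var-≢ {x} {z} λ { refl → z∉ (here refl) }))
    ([]-var Γ (z∉ ∘ there))

  []-lam : ∀ t Γ → z ∉ dom Γ → lam z t [ Γ ] ≡ lam z (t [ Γ ])
  []-lam t []            _   = refl
  []-lam {z} t ((x , a) ∷ Γ) z∉ = trans
    (cong (_[ Γ ]) (⟨≔⟩-lam-≢ {x} {z} λ { refl → z∉ (here refl) }))
    ([]-lam (t ⟨ x ≔ a ⟩) Γ (z∉ ∘ there))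

  dom-++ : ∀ Γ Δ → dom (Γ ++ Δ) ≡ dom Γ ++ dom Δ
  dom-++ Γ Δ = map-++ proj₁ Γ Δ

  ∈-dom-++⁺ˡ : ∀ Γ Δ → x ∈ dom Γ → x ∈ dom (Γ ++ Δ)
  ∈-dom-++⁺ˡ Γ Δ x∈Γ = subst (_ ∈_) (sym (dom-++ Γ Δ)) (∈-++⁺ˡ x∈Γ)

  ∈-dom-++⁺ʳ : ∀ Γ Δ → x ∈ dom Δ → x ∈ dom (Γ ++ Δ)
  ∈-dom-++⁺ʳ Γ Δ x∈Δ = subst (_ ∈_) (sym (dom-++ Γ Δ)) (∈-++⁺ʳ (dom Γ) x∈Δ)

  ∈-dom-++⁻ : ∀ Γ Δ → x ∈ dom (Γ ++ Δ) → x ∈ dom Γ ⊎ x ∈ dom Δ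
  ∈-dom-++⁻ Γ Δ x∈ = ∈-++⁻ (dom Γ) (subst (_ ∈_) (dom-++ Γ Δ) x∈)

  Unique-dom-++⁻ : ∀ Γ Δ → Unique (dom (Γ ++ Δ)) → Disjoint (dom Γ) (dom Δ) × Unique (dom Δ)
  Unique-dom-++⁻ Γ Δ Γ++Δ! = Unique-++⇒Disjoint (dom Γ) Γ++Δ!′ , Unique-++⇒Uniqueʳ (dom Γ) Γ++Δ!′
    where
      Γ++Δ!′ : Unique (dom Γ ++ dom Δ)
      Γ++Δ!′ = subst Unique (dom-++ Γ Δ) Γ++Δ!

  ⊢-closed : ∀ Γ → Γ ⊢ t ∶ a → Closed (t [ Γ ])
  ⊢-closed {t} Γ (fv⊆Γ , _) = []-closed t Γ fv⊆Γ

  ⊢-weakenʳ : ∀ Γ Δ → Γ ⊢ t ∶ a → (Γ ++ Δ) ⊢ t ∶ a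
  ⊢-weakenʳ {t} {a} Γ Δ ⊢t@(fv⊆Γ , ⟦t⟧≼a) =
    (λ x x∈t → ∈-dom-++⁺ˡ Γ Δ (fv⊆Γ x x∈t)) ,
    subst (λ s → ⟦ s ⟧ ≼ a) (sym t[Γ++Δ]≡t[Γ]) ⟦t⟧≼a
    where
      t[Γ++Δ]≡t[Γ] : t [ Γ ++ Δ ] ≡ t [ Γ ]
      t[Γ++Δ]≡t[Γ] = trans ([]-++ t Γ Δ) ([]-closed-id (t [ Γ ]) Δ (⊢-closed Γ ⊢t))

  ⊢-weakenˡ : ∀ Γ Δ → Disjoint (dom Γ) (dom Δ) → Δ ⊢ t ∶ a → (Γ ++ Δ) ⊢ t ∶ a
  ⊢-weakenˡ {t} {a} Γ Δ Γ#Δ (fv⊆Δ , ⟦t⟧≼a) =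
    (λ x x∈t → ∈-dom-++⁺ʳ Γ Δ (fv⊆Δ x x∈t)) ,
    subst (λ s → ⟦ s ⟧ ≼ a) (sym t[Γ++Δ]≡t[Δ]) ⟦t⟧≼a
    where
      t[Γ++Δ]≡t[Δ] : t [ Γ ++ Δ ] ≡ t [ Δ ]
      t[Γ++Δ]≡t[Δ] = trans ([]-++ t Γ Δ)
        (cong (_[ Δ ]) ([]-fresh t Γ λ x x∈t x∈Γ → Γ#Δ (x∈Γ , fv⊆Δ x x∈t)))

  ⊢-pair : ∀ Γ → z ∉ dom Γ → Γ ⊢ t ∶ a → Γ ⊢ u ∶ b →
           Γ ⊢ lam z (app (app (var z) t) u) ∶ a ⊗ b
  ⊢-pair {z} {t} {u = u} Γ z∉Γ ⊢t@(fv⊆Γ , ⟦t⟧≼a) ⊢u@(fu⊆Γ , ⟦u⟧≼b) = fv⊆ ,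
    subst (_≼ _) (cong ⟦_⟧ (sym substituted))
      (⟦pair⟧-≼ (⊢-closed Γ ⊢t) (⊢-closed Γ ⊢u) ⟦t⟧≼a ⟦u⟧≼b)
    where
      fv⊆ : ∀ x → FreeIn x (lam z (app (app (var z) t) u)) → x ∈ dom Γ
      fv⊆ x (fv-lam x≢z (fv-appˡ (fv-appˡ fv-var))) = ⊥-elim (x≢z refl)
      fv⊆ x (fv-lam _   (fv-appˡ (fv-appʳ x∈t)))    = fv⊆Γ x x∈t
      fv⊆ x (fv-lam _   (fv-appʳ x∈u))              = fu⊆Γ x x∈u
      substituted : lam z (app (app (var z) t) u) [ Γ ] ≡ lam z (app (app (var z) (t [ Γ ])) (u [ Γ ]))
      substituted = begin
        lam z (app (app (var z) t) u) [ Γ ]                ≡⟨ []-lam _ Γ z∉Γ ⟩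
        lam z (app (app (var z) t) u [ Γ ])                ≡⟨ cong (lam z) ([]-app _ u Γ) ⟩
        lam z (app (app (var z) t [ Γ ]) (u [ Γ ]))        ≡⟨ cong (λ s → lam z (app s (u [ Γ ]))) ([]-app (var z) t Γ) ⟩
        lam z (app (app (var z [ Γ ]) (t [ Γ ])) (u [ Γ ])) ≡⟨ cong (λ s → lam z (app (app s (t [ Γ ])) (u [ Γ ]))) ([]-var Γ z∉Γ) ⟩
        lam z (app (app (var z) (t [ Γ ])) (u [ Γ ]))      ∎
        where open ≡-Reasoning

  ⊢-unpair : ∀ Γ → x ∉ dom Γ → y ∉ dom Γ → x ≢ y → z ∉ dom Γ → z ≢ x → z ≢ y →
             Γ ++ (x , a) ∷ (y , b) ∷ [] ⊢ t ∶ c →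
             Γ ++ (z , a ⊗ b) ∷ [] ⊢ app (var z) (lam x (lam y t)) ∶ c
  ⊢-unpair {x} {y} {z} {a} {b} {t} {c} Γ x∉Γ y∉Γ x≢y z∉Γ z≢x z≢y (fv⊆Γxy , ⟦t⟧≼c) =
    fv⊆ , subst (_≼ c) (cong ⟦_⟧ (sym substituted))
            (⟦unpair⟧-≼ x≢y (subst (λ s → ⟦ s ⟧ ≼ c) ([]-++ t Γ _) ⟦t⟧≼c))
    where
      open ≡-Reasoning
      ∈-dom-Γ : ∀ w → FreeIn w t → w ≢ x → w ≢ y → w ∈ dom Γ
      ∈-dom-Γ w w∈t w≢x w≢y with ∈-dom-++⁻ Γ _ (fv⊆Γxy w w∈t)
      ... | inj₁ w∈Γ               = w∈Γ
      ... | inj₂ (here w≡x)        = ⊥-elim (w≢x w≡x)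
      ... | inj₂ (there (here w≡y)) = ⊥-elim (w≢y w≡y)
      fv⊆ : ∀ w → FreeIn w (app (var z) (lam x (lam y t))) → w ∈ dom (Γ ++ (z , a ⊗ b) ∷ [])
      fv⊆ w (fv-appˡ fv-var)                          = ∈-dom-++⁺ʳ Γ _ (here refl)
      fv⊆ w (fv-appʳ (fv-lam w≢x (fv-lam w≢y w∈t))) = ∈-dom-++⁺ˡ Γ _ (∈-dom-Γ w w∈t w≢x w≢y)
      z-fresh : ¬ FreeIn z (lam x (lam y (t [ Γ ])))
      z-fresh (fv-lam _ (fv-lam _ z∈t[Γ])) with FreeIn-[]⁻ t Γ z∈t[Γ]
      ... | z∈t , _ = z∉Γ (∈-dom-Γ z z∈t z≢x z≢y)
      substituted : app (var z) (lam x (lam y t)) [ Γ ++ (z , a ⊗ b) ∷ [] ] ≡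
                    app (par (a ⊗ b)) (lam x (lam y (t [ Γ ])))
      substituted = begin
        app (var z) (lam x (lam y t)) [ Γ ++ (z , a ⊗ b) ∷ [] ]
          ≡⟨ []-++ (app (var z) (lam x (lam y t))) Γ _ ⟩
        app (var z) (lam x (lam y t)) [ Γ ] ⟨ z ≔ a ⊗ b ⟩
          ≡⟨ cong (_⟨ z ≔ a ⊗ b ⟩) ([]-app (var z) (lam x (lam y t)) Γ) ⟩
        app (var z [ Γ ]) (lam x (lam y t) [ Γ ]) ⟨ z ≔ a ⊗ b ⟩
          ≡⟨ cong₂ (λ s r → app s r ⟨ z ≔ a ⊗ b ⟩) ([]-var Γ z∉Γ)
                   (trans ([]-lam (lam y t) Γ x∉Γ) (cong (lam x) ([]-lam t Γ y∉Γ))) ⟩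
        app (var z) (lam x (lam y (t [ Γ ]))) ⟨ z ≔ a ⊗ b ⟩
          ≡⟨ cong₂ app (⟨≔⟩-var-≡ {z}) (⟨≔⟩-fresh (lam x (lam y (t [ Γ ]))) z-fresh) ⟩
        app (par (a ⊗ b)) (lam x (lam y (t [ Γ ])))
          ∎

open D using (Context; Term; dom; _⊢_∶_; _⊗_)
open ImplicativeStructure using (Carrier)

proposition3p7 : ∀ {ℓ : Level} (𝒜 : ImplicativeStructure ℓ) →
    (∀ (Γ Δ : Context 𝒜) (t u : Term 𝒜) (a b : Carrier 𝒜) (z : Var) →
      Unique (dom 𝒜 (Γ ++ Δ)) → z ∉ dom 𝒜 (Γ ++ Δ) →
      _⊢_∶_ 𝒜 Γ t a → _⊢_∶_ 𝒜 Δ u b →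
      _⊢_∶_ 𝒜 (Γ ++ Δ) (lam z (app (app (var z) t) u)) (_⊗_ 𝒜 a b))
    ×
    (∀ (Γ : Context 𝒜) (x y z : Var) (a b c : Carrier 𝒜) (t : Term 𝒜) →
      Unique (dom 𝒜 (Γ ++ (x , a) ∷ (y , b) ∷ [])) →
      z ∉ dom 𝒜 Γ → z ≢ x → z ≢ y →
      _⊢_∶_ 𝒜 (Γ ++ (x , a) ∷ (y , b) ∷ []) t c →
      _⊢_∶_ 𝒜 (Γ ++ (z , _⊗_ 𝒜 a b) ∷ []) (app (var z) (lam x (lam y t))) c)
proposition3p7 𝒜 =
  (λ Γ Δ t u a b z Γ++Δ! z∉Γ++Δ ⊢t ⊢u →
    let (Γ#Δ , _) = Unique-dom-++⁻ Γ Δ Γ++Δ! in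
    ⊢-pair (Γ ++ Δ) z∉Γ++Δ (⊢-weakenʳ Γ Δ ⊢t) (⊢-weakenˡ Γ Δ Γ#Δ ⊢u)) ,
  (λ Γ x y z a b c t Γxy! z∉Γ z≢x z≢y ⊢t →
    let (Γ#xy , xy!) = Unique-dom-++⁻ Γ _ Γxy! in
    ⊢-unpair Γ (λ x∈Γ → Γ#xy (x∈Γ , here refl)) (λ y∈Γ → Γ#xy (y∈Γ , there (here refl)))
      (λ x≡y → Unique[x∷xs]⇒x∉xs xy! (here x≡y)) z∉Γ z≢x z≢y ⊢t)
  where open TensorRules 𝒜 using (Unique-dom-++⁻; ⊢-weakenʳ; ⊢-weakenˡ; ⊢-pair; ⊢-unpair)
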